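{- Consider the two-identical-parallel-machine scheduling problem with jobs $1,\dots,n$ having integer processing times $p_i$ and integer delivery times $q_i\ge 0$, indexed so that $q_1\ge q_2\ge\cdots\ge q_n$. Let $\chi_1,\dots,\chi_n$ be the state sets produced by the exact dynamic program $A$ and $\chi_1^\#,\dots,\chi_n^\#$ the state sets produced by the approximate algorithm $A'$ for a given $\epsilon>0$ (both described in the context). Then for every $i\in\{1,\dots,n\}$ and every state $[k,L_{max},C_{max}]\in\chi_i$ there exists at least one state $[m,L_{max}^\#,C_{max}^\#]\in\chi_i^\#$ such that \[L_{max}^\#\le L_{max}+i\cdot\max\{\delta_1,\delta_2\}\] and \[C_{max}-i\cdot\delta_1\le C_{max}^\#\le C_{max}+i\cdot\delta_1,\] where $\delta_1=\frac{\epsilon P/2}{n}$, $\delta_2=\frac{\epsilon (P+q_{max})/3}{n}$, $P=\sum_{j=1}^n p_j$ and $q_{max}=\max_j q_j$.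
   Context: Problem: $n$ jobs are to be scheduled on two identical machines available from time $0$, each processing at most one job at a time; job $i$ has processing time $p_i$ and delivery time $q_i$. The lateness-type objective is $L_{max}=\max_i (C_i+q_i)$ where $C_i$ is the completion time of job $i$, and the makespan is $C_{max}=\max_i C_i$. Let $S_i=\sum_{j=1}^i p_j$. A state is a triple $[k,L_{max},C_{max}]$ with $k\in\{0,1\}$ (the most loaded machine), $L_{max}$ the maximum lateness and $C_{max}$ the maximum completion time of a partial schedule of the first $i$ jobs. Algorithm $A$ (exact dynamic program): set $\chi_1=\{[1,p_1+q_1,p_1]\}$. For $i=2,\dots,n$: start with $\chi_i=\emptyset$; for every state $[k,L,C]\in\chi_{i-1}$, add $[k,\max\{L,C+p_i+q_i\},C+p_i]$ to $\chi_i$ (job $i$ on machine $k$); and (job $i$ on machine $1-k$) if $C\ge S_i-C$ add $[k,\max\{L,S_i-C+q_i\},C]$ to $\chi_i$, otherwise add $[1-k,\max\{L,S_i-C+q_i\},S_i-C]$ to $\chi_i$. Then, for every value of $k$ and every value of $C_{max}$, keep in $\chi_i$ only one state with the smallest $L_{max}$. Algorithm $A'$ (approximation): given $\epsilon>0$, define $\delta_1,\delta_2$ as in the claim. Divide $[0,P]$ into consecutive subintervals of length $\delta_1$ and $[0,P+q_{max}]$ into consecutive subintervals of length $\delta_2$; a "box" is a pair (subinterval of $[0,P]$, subinterval of $[0,P+q_{max}]$), and a state $[k,L,C]$ lies in the box containing $(C,L)$. $A'$ proceeds exactly as $A$, starting from $\chi_1^\#=\chi_1$ and generating $\chi_i^\#$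 from the states of $\chi_{i-1}^\#$ by the same transitions, except that after generating the states of iteration $i$ it keeps only one (arbitrary) representative state in each box. -}

module Defs where

open import Data.Bool using (Bool; true; false; not; if_then_else_)
open import Data.Nat as ℕ using (ℕ; zero; suc; _∸_; _≤ᵇ_)
open import Data.Integer using (+_)
open import Data.Rational as ℚ using (ℚ)
open import Data.Product using (Σ; ∃; _×_; _,_)
open import Data.Sum using (_⊎_)
open import Data.Empty using (⊥)
open import Relation.Binary.PropositionalEquality using (_≡_)

toℚ : ℕ → ℚ
toℚ m = (+ m) ℚ./ 1

-- 1/n (with the junk value 0 for n = 0; the theorem assumes n ≥ 1)
recipℕ : ℕ → ℚ
recipℕ zero = ℚ.0ℚ
recipℕ (suc m) = (+ 1) ℚ./ (suc m)

-- S_i = p_1 + ... + p_i  (jobs are indexed 1..n; p 0 is never used)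
S : (ℕ → ℕ) → ℕ → ℕ
S p zero = 0
S p (suc i) = S p i ℕ.+ p (suc i)

qmaxUpTo : (ℕ → ℕ) → ℕ → ℕ
qmaxUpTo q zero = 0
qmaxUpTo q (suc j) = qmaxUpTo q j ℕ.⊔ q (suc j)

-- A state [k, Lmax, Cmax]; k ∈ {0,1} encoded as Bool (true = 1), 1-k = not k
record State : Set where
  constructor [_,_,_]
  field
    k : Bool
    Lmax : ℕ
    Cmax : ℕ
open State public

initState : (p q : ℕ → ℕ) → State
initState p q = [ true , p 1 ℕ.+ q 1 , p 1 ]

-- job i on the most loaded machine k
step₁ : (p q : ℕ → ℕ) → ℕ → State → State
step₁ p q i [ k , L , C ] = [ k , L ℕ.⊔ (C ℕ.+ p i ℕ.+ q i) , C ℕ.+ p i ]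

-- job i on machine 1-k
step₂ : (p q : ℕ → ℕ) → ℕ → State → State
step₂ p q i [ k , L , C ] =
  if (S p i ∸ C) ≤ᵇ C
  then [ k , L ℕ.⊔ (S p i ∸ C ℕ.+ q i) , C ]
  else [ not k , L ℕ.⊔ (S p i ∸ C ℕ.+ q i) , S p i ∸ C ]

Gen : (p q : ℕ → ℕ) → ℕ → (State → Set) → State → Set
Gen p q i X s = Σ State λ s₀ → X s₀ × ((s ≡ step₁ p q i s₀) ⊎ (s ≡ step₂ p q i s₀))

-- Exact dynamic program A: χ i (χ 0 is empty and unused).
-- After generation, for each (k, Cmax) only the state with smallest Lmax is kept.
χ : (p q : ℕ → ℕ) → ℕ → State → Set
χ p q zero s = ⊥
χ p q (suc zero) s = s ≡ initState p q
χ p q (suc (suc m)) s =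
  Gen p q (suc (suc m)) (χ p q (suc m)) s ×
  (∀ s′ → Gen p q (suc (suc m)) (χ p q (suc m)) s′ →
     k s′ ≡ k s → Cmax s′ ≡ Cmax s → Lmax s ℕ.≤ Lmax s′)

InSub : ℚ → ℕ → ℕ → Set
InSub δ j x = (toℚ j ℚ.* δ ℚ.≤ toℚ x) × (toℚ x ℚ.< toℚ (suc j) ℚ.* δ)

SameBox : ℚ → ℚ → State → State → Set
SameBox δ₁ δ₂ s t =
  Σ ℕ λ j₁ → Σ ℕ λ j₂ →
    InSub δ₁ j₁ (Cmax s) × InSub δ₁ j₁ (Cmax t) ×
    InSub δ₂ j₂ (Lmax s) × InSub δ₂ j₂ (Lmax t)

δ₁ : (p : ℕ → ℕ) → ℕ → ℚ → ℚ
δ₁ p n ε = ε ℚ.* toℚ (S p n) ℚ.* ℚ.½ ℚ.* recipℕ n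

δ₂ : (p q : ℕ → ℕ) → ℕ → ℚ → ℚ
δ₂ p q n ε = ε ℚ.* toℚ (S p n ℕ.+ qmaxUpTo q n) ℚ.* ((+ 1) ℚ./ 3) ℚ.* recipℕ n

-- R is a possible run of the approximation algorithm A′ (the representative
-- kept in each box is arbitrary, so A′ is described as a relation):
--   χ#_1 = χ_1; for 2 ≤ i ≤ n, χ#_i consists of states generated from χ#_{i-1},
--   every box containing a generated state contains a kept state,
--   and at most one state is kept per box.
IsRunA′ : (p q : ℕ → ℕ) → ℕ → ℚ → (ℕ → State → Set) → Set
IsRunA′ p q n ε R =
  (∀ s → R 1 s → s ≡ initState p q) ×
  R 1 (initState p q) ×
  (∀ i → 2 ℕ.≤ i → i ℕ.≤ n →
     (∀ s → R i s → Gen p q i (R (i ∸ 1)) s) ×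
     (∀ s → Gen p q i (R (i ∸ 1)) s →
        Σ State λ t → R i t × SameBox (δ₁ p n ε) (δ₂ p q n ε) s t) ×
     (∀ s t → R i s → R i t → SameBox (δ₁ p n ε) (δ₂ p q n ε) s t → s ≡ t))

-- Every state s of the exact program A is shadowed by a state t of A′: along the
-- run, Lmax t ≤ Lmax s + E and |Cmax t − Cmax s| ≤ e.  Both transitions of A are
-- monotone in (Lmax, Cmax) and non-expansive in Cmax (the second one reflects
-- Cmax through S_i − Cmax), so applying the same transition to s and t keeps these
-- bounds, provided e ≤ E since Cmax also enters Lmax.  Replacing the result by the
-- representative of its box costs at most δ₁ on Cmax and δ₂ on Lmax, so after i
-- iterations e = i·δ₁ and E = i·max(δ₁, δ₂).
module Submission where

open import Defs
open import Data.Nat as ℕ using (ℕ)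
open import Data.Rational as ℚ using (ℚ)
open import Data.Product using (Σ; _×_; _,_; proj₁; proj₂)

open import Data.Bool using (true; false)
open import Data.Nat using (zero; suc; _∸_; _⊔_; _≤ᵇ_; z≤n; s≤s)
import Data.Nat.Properties as ℕₚ
open import Data.Integer using (+_; +≤+) renaming (_≤_ to _≤ℤ_)
import Data.Integer.Properties as ℤₚ
open import Data.Rational using (mkℚ; 0ℚ; 1ℚ; _≤_; _<_; _+_; _*_; _-_; -_)
import Data.Rational.Properties as ℚₚ
open import Data.Nat.Coprimality using (sym; 1-coprimeTo)
open import Data.Rational.Solver using (module +-*-Solver)
open import Data.Sum using (_⊎_; inj₁; inj₂)
open import Relation.Nullary.Reflects using (ofʸ; ofⁿ)
open import Relation.Binary.PropositionalEquality
  using (_≡_; refl; cong; subst; subst₂; module ≡-Reasoning)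
  renaming (sym to ≡-sym)

open +-*-Solver

-- On the normal form m/1 the operations of ℚ reduce to those of ℤ.
toℚ≡mkℚ : ∀ m → toℚ m ≡ mkℚ (+ m) 0 (sym (1-coprimeTo m))
toℚ≡mkℚ m = ℚₚ.↥p/↧p≡p (mkℚ (+ m) 0 (sym (1-coprimeTo m)))

toℚ-+ : ∀ a b → toℚ (a ℕ.+ b) ≡ toℚ a + toℚ b
toℚ-+ a b rewrite toℚ≡mkℚ a | toℚ≡mkℚ b
                | ℤₚ.*-identityʳ (+ a) | ℤₚ.*-identityʳ (+ b) = refl

toℚ-mono-≤ : ∀ {a b} → a ℕ.≤ b → toℚ a ≤ toℚ b
toℚ-mono-≤ {a} {b} a≤b rewrite toℚ≡mkℚ a | toℚ≡mkℚ b =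
  ℚ.*≤* (subst₂ _≤ℤ_ (≡-sym (ℤₚ.*-identityʳ (+ a))) (≡-sym (ℤₚ.*-identityʳ (+ b)))
                      (+≤+ a≤b))

toℚ-nonNeg : ∀ m → 0ℚ ≤ toℚ m
toℚ-nonNeg m = toℚ-mono-≤ (z≤n {m})

toℚ-suc-* : ∀ m d → toℚ (suc m) * d ≡ toℚ m * d + d
toℚ-suc-* m d = begin
  toℚ (suc m) * d      ≡⟨ cong (λ x → toℚ x * d) (ℕₚ.+-comm 1 m) ⟩
  toℚ (m ℕ.+ 1) * d    ≡⟨ cong (_* d) (toℚ-+ m 1) ⟩
  (toℚ m + 1ℚ) * d     ≡⟨ solve 2 (λ a d → (a :+ con 1ℚ) :* d := a :* d :+ d) refl (toℚ m) d ⟩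
  toℚ m * d + d        ∎
  where open ≡-Reasoning

*-nonNeg : ∀ {a b} → 0ℚ ≤ a → 0ℚ ≤ b → 0ℚ ≤ a * b
*-nonNeg {a} {b} a≥0 b≥0 = ℚₚ.nonNegative⁻¹ (a * b)
  {{ℚₚ.nonNeg*nonNeg⇒nonNeg a {{ℚ.nonNegative a≥0}} b {{ℚ.nonNegative b≥0}}}}

toℚ-*-monoʳ-≤ : ∀ m {a b} → a ≤ b → toℚ m * a ≤ toℚ m * b
toℚ-*-monoʳ-≤ m = ℚₚ.*-monoˡ-≤-nonNeg (toℚ m) {{ℚ.nonNegative (toℚ-nonNeg m)}}

recipℕ-nonNeg : ∀ n → 0ℚ ≤ recipℕ n
recipℕ-nonNeg zero    = ℚₚ.≤-refl
recipℕ-nonNeg (suc m) = ℚₚ.nonNegative⁻¹ _ {{ℚₚ.normalize-nonNeg 1 (suc m)}}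

δ₁-nonNeg : ∀ p n {ε} → 0ℚ < ε → 0ℚ ≤ δ₁ p n ε
δ₁-nonNeg p n ε>0 =
  *-nonNeg (*-nonNeg (*-nonNeg (ℚₚ.<⇒≤ ε>0) (toℚ-nonNeg (S p n))) (ℚₚ.<⇒≤ (ℚₚ.positive⁻¹ ℚ.½)))
           (recipℕ-nonNeg n)

infix 4 _≲[_]_

record _≲[_]_ (x : ℕ) (e : ℚ) (y : ℕ) : Set where
  constructor within
  field bound : toℚ x ≤ toℚ y + e
open _≲[_]_

≲-refl : ∀ {x e} → 0ℚ ≤ e → x ≲[ e ] x
≲-refl {x} e≥0 = within (subst (_≤ toℚ x + _) (ℚₚ.+-identityʳ (toℚ x)) (ℚₚ.+-monoʳ-≤ (toℚ x) e≥0))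

≲-weaken : ∀ {x y e E} → e ≤ E → x ≲[ e ] y → x ≲[ E ] y
≲-weaken {y = y} e≤E (within x≤y+e) = within (ℚₚ.≤-trans x≤y+e (ℚₚ.+-monoʳ-≤ (toℚ y) e≤E))

≤-≲-trans : ∀ {x y z e} → x ℕ.≤ y → y ≲[ e ] z → x ≲[ e ] z
≤-≲-trans x≤y (within y≤z+e) = within (ℚₚ.≤-trans (toℚ-mono-≤ x≤y) y≤z+e)

≲-≤-trans : ∀ {x y z e} → x ≲[ e ] y → y ℕ.≤ z → x ≲[ e ] z
≲-≤-trans {e = e} (within x≤y+e) y≤z = within (ℚₚ.≤-trans x≤y+e (ℚₚ.+-monoˡ-≤ e (toℚ-mono-≤ y≤z)))

≲-trans : ∀ {x y z e e′} → x ≲[ e ] y → y ≲[ e′ ] z → x ≲[ e′ + e ] z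
≲-trans {z = z} {e} {e′} (within x≤y+e) (within y≤z+e′) = within
  (subst (_ ≤_) (solve 3 (λ z e′ e → (z :+ e′) :+ e := z :+ (e′ :+ e)) refl (toℚ z) e′ e)
         (ℚₚ.≤-trans x≤y+e (ℚₚ.+-monoˡ-≤ e y≤z+e′)))

≲-+ʳ : ∀ {x y e} c → x ≲[ e ] y → x ℕ.+ c ≲[ e ] y ℕ.+ c
≲-+ʳ {x} {y} {e} c (within x≤y+e) = within (begin
  toℚ (x ℕ.+ c)          ≡⟨ toℚ-+ x c ⟩
  toℚ x + toℚ c          ≤⟨ ℚₚ.+-monoˡ-≤ (toℚ c) x≤y+e ⟩
  (toℚ y + e) + toℚ c    ≡⟨ solve 3 (λ y e c → (y :+ e) :+ c := (y :+ c) :+ e) refl (toℚ y) e (toℚ c) ⟩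
  (toℚ y + toℚ c) + e    ≡⟨ cong (_+ e) (≡-sym (toℚ-+ y c)) ⟩
  toℚ (y ℕ.+ c) + e      ∎)
  where open ℚₚ.≤-Reasoning

≲-+ˡ⁻¹ : ∀ {x y e} c → c ℕ.+ x ≲[ e ] c ℕ.+ y → x ≲[ e ] y
≲-+ˡ⁻¹ {x} {y} {e} c (within c+x≤c+y+e) = within (begin
  toℚ x                           ≡⟨ solve 2 (λ c x → x := (:- c) :+ (c :+ x)) refl (toℚ c) (toℚ x) ⟩
  - toℚ c + (toℚ c + toℚ x)       ≡⟨ cong (λ z → - toℚ c + z) (≡-sym (toℚ-+ c x)) ⟩
  - toℚ c + toℚ (c ℕ.+ x)         ≤⟨ ℚₚ.+-monoʳ-≤ (- toℚ c) c+x≤c+y+e ⟩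
  - toℚ c + (toℚ (c ℕ.+ y) + e)   ≡⟨ cong (λ z → - toℚ c + (z + e)) (toℚ-+ c y) ⟩
  - toℚ c + ((toℚ c + toℚ y) + e) ≡⟨ solve 3 (λ c y e → (:- c) :+ ((c :+ y) :+ e) := y :+ e) refl (toℚ c) (toℚ y) e ⟩
  toℚ y + e                       ∎)
  where open ℚₚ.≤-Reasoning

≲-⊔ : ∀ {x x′ y y′ e} → x ≲[ e ] y → x′ ≲[ e ] y′ → x ⊔ x′ ≲[ e ] y ⊔ y′
≲-⊔ {x} {x′} {y} {y′} x≲y x′≲y′ with ℕₚ.≤-total x x′
... | inj₁ x≤x′ rewrite ℕₚ.m≤n⇒m⊔n≡n x≤x′ = ≲-≤-trans x′≲y′ (ℕₚ.m≤n⊔m y y′)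
... | inj₂ x′≤x rewrite ℕₚ.m≥n⇒m⊔n≡m x′≤x = ≲-≤-trans x≲y (ℕₚ.m≤m⊔n y y′)

≲-∸ : ∀ {x y e} c → 0ℚ ≤ e → x ≲[ e ] y → c ∸ y ≲[ e ] c ∸ x
≲-∸ {x} {y} c e≥0 x≲y with ℕₚ.≤-total c y
... | inj₁ c≤y rewrite ℕₚ.m≤n⇒m∸n≡0 c≤y = within (ℚₚ.+-mono-≤ (toℚ-nonNeg (c ∸ x)) e≥0)
... | inj₂ y≤c = ≲-+ˡ⁻¹ y
  (≤-≲-trans (ℕₚ.≤-reflexive (ℕₚ.m+[n∸m]≡n y≤c))
  (≤-≲-trans (ℕₚ.m≤n+m∸n c x) (≲-+ʳ (c ∸ x) x≲y)))

≲⇒-≤ : ∀ {x y e} → x ≲[ e ] y → toℚ x - e ≤ toℚ y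
≲⇒-≤ {y = y} {e} (within x≤y+e) =
  subst (_ ≤_) (solve 2 (λ y e → (y :+ e) :+ (:- e) := y) refl (toℚ y) e)
        (ℚₚ.+-monoˡ-≤ (- e) x≤y+e)

step₂-Cmax : ∀ p q i s → Cmax (step₂ p q i s) ≡ Cmax s ⊔ (S p i ∸ Cmax s)
step₂-Cmax p q i [ k , L , C ] with (S p i ∸ C) ≤ᵇ C | ℕₚ.≤ᵇ-reflects-≤ (S p i ∸ C) C
... | true  | ofʸ S∸C≤C = ≡-sym (ℕₚ.m≥n⇒m⊔n≡m S∸C≤C)
... | false | ofⁿ S∸C≰C = ≡-sym (ℕₚ.m≤n⇒m⊔n≡n (ℕₚ.≰⇒≥ S∸C≰C))

step₂-Lmax : ∀ p q i s → Lmax (step₂ p q i s) ≡ Lmax s ⊔ (S p i ∸ Cmax s ℕ.+ q i)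
step₂-Lmax p q i [ k , L , C ] with (S p i ∸ C) ≤ᵇ C
... | true  = refl
... | false = refl

Approx : ℚ → ℚ → State → State → Set
Approx e E s t = Lmax t ≲[ E ] Lmax s × Cmax t ≲[ e ] Cmax s × Cmax s ≲[ e ] Cmax t

approx-refl : ∀ {e E} s → 0ℚ ≤ e → 0ℚ ≤ E → Approx e E s s
approx-refl s e≥0 E≥0 = ≲-refl E≥0 , ≲-refl e≥0 , ≲-refl e≥0

approx-trans : ∀ {e E d D s t′ t} → Approx e E s t′ → Approx d D t′ t → Approx (e + d) (E + D) s t
approx-trans {e} {d = d} {s = s} {t = t} (Lt′≲Ls , Ct′≲Cs , Cs≲Ct′) (Lt≲Lt′ , Ct≲Ct′ , Ct′≲Ct) =
  ≲-trans Lt≲Lt′ Lt′≲Ls ,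
  ≲-trans Ct≲Ct′ Ct′≲Cs ,
  subst (λ f → Cmax s ≲[ f ] Cmax t) (ℚₚ.+-comm d e) (≲-trans Cs≲Ct′ Ct′≲Ct)

step₁-approx : ∀ p q i {e E} s t → e ≤ E → Approx e E s t →
               Approx e E (step₁ p q i s) (step₁ p q i t)
step₁-approx p q i [ _ , _ , _ ] [ _ , _ , _ ] e≤E (Lt≲Ls , Ct≲Cs , Cs≲Ct) =
  ≲-⊔ Lt≲Ls (≲-weaken e≤E (≲-+ʳ (q i) (≲-+ʳ (p i) Ct≲Cs))) ,
  ≲-+ʳ (p i) Ct≲Cs ,
  ≲-+ʳ (p i) Cs≲Ct

step₂-approx : ∀ p q i {e E} s t → e ≤ E → 0ℚ ≤ e → Approx e E s t →
               Approx e E (step₂ p q i s) (step₂ p q i t)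
step₂-approx p q i s t e≤E e≥0 (Lt≲Ls , Ct≲Cs , Cs≲Ct)
  rewrite step₂-Lmax p q i s | step₂-Lmax p q i t | step₂-Cmax p q i s | step₂-Cmax p q i t =
  ≲-⊔ Lt≲Ls (≲-weaken e≤E (≲-+ʳ (q i) (≲-∸ (S p i) e≥0 Cs≲Ct))) ,
  ≲-⊔ Ct≲Cs (≲-∸ (S p i) e≥0 Cs≲Ct) ,
  ≲-⊔ Cs≲Ct (≲-∸ (S p i) e≥0 Ct≲Cs)

Transition : (p q : ℕ → ℕ) → ℕ → State → State → Set
Transition p q i s₀ s = (s ≡ step₁ p q i s₀) ⊎ (s ≡ step₂ p q i s₀)

transition-approx : ∀ p q i {e E s₀ t₀ s} → e ≤ E → 0ℚ ≤ e → Approx e E s₀ t₀ →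
                    Transition p q i s₀ s → Σ State λ t → Transition p q i t₀ t × Approx e E s t
transition-approx p q i {s₀ = s₀} {t₀} e≤E _ s₀≈t₀ (inj₁ refl) =
  step₁ p q i t₀ , inj₁ refl , step₁-approx p q i s₀ t₀ e≤E s₀≈t₀
transition-approx p q i {s₀ = s₀} {t₀} e≤E e≥0 s₀≈t₀ (inj₂ refl) =
  step₂ p q i t₀ , inj₂ refl , step₂-approx p q i s₀ t₀ e≤E e≥0 s₀≈t₀

inSub-≲ : ∀ {δ x y} j → InSub δ j x → InSub δ j y → y ≲[ δ ] x
inSub-≲ {δ} {x} {y} j (jδ≤x , _) (_ , y<[j+1]δ) = within (ℚₚ.<⇒≤ (begin-strict
  toℚ y              <⟨ y<[j+1]δ ⟩
  toℚ (suc j) * δ    ≡⟨ toℚ-suc-* j δ ⟩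
  toℚ j * δ + δ      ≤⟨ ℚₚ.+-monoˡ-≤ δ jδ≤x ⟩
  toℚ x + δ          ∎))
  where open ℚₚ.≤-Reasoning

sameBox-approx : ∀ {δ δ′ E t′ t} → δ′ ≤ E → SameBox δ δ′ t′ t → Approx δ E t′ t
sameBox-approx δ′≤E (j₁ , j₂ , C′∈ , C∈ , L′∈ , L∈) =
  ≲-weaken δ′≤E (inSub-≲ j₂ L′∈ L∈) , inSub-≲ j₁ C′∈ C∈ , inSub-≲ j₁ C∈ C′∈

module _ {n p q ε} (ε>0 : 0ℚ < ε) {R : ℕ → State → Set} (run : IsRunA′ p q n ε R) where

  private
    d D : ℚ
    d = δ₁ p n ε
    D = δ₁ p n ε ℚ.⊔ δ₂ p q n ε

    d≥0 : 0ℚ ≤ d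
    d≥0 = δ₁-nonNeg p n ε>0

    d≤D : d ≤ D
    d≤D = ℚₚ.p≤p⊔q d (δ₂ p q n ε)

    δ₂≤D : δ₂ p q n ε ≤ D
    δ₂≤D = ℚₚ.p≤q⊔p d (δ₂ p q n ε)

    representativeOf : ∀ m → suc (suc m) ℕ.≤ n → ∀ t′ → Gen p q (suc (suc m)) (R (suc m)) t′ →
                       Σ State λ t → R (suc (suc m)) t × SameBox d (δ₂ p q n ε) t′ t
    representativeOf m m+2≤n = proj₁ (proj₂ (proj₂ (proj₂ run) (suc (suc m)) (s≤s (s≤s z≤n)) m+2≤n))

  run-approximates-χ : ∀ m → suc m ℕ.≤ n → ∀ s → χ p q (suc m) s →
                       Σ State λ t → R (suc m) t × Approx (toℚ (suc m) * d) (toℚ (suc m) * D) s t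
  run-approximates-χ zero _ s refl =
    initState p q , proj₁ (proj₂ run) ,
    approx-refl s (*-nonNeg {toℚ 1} (toℚ-nonNeg 1) d≥0) (*-nonNeg {toℚ 1} (toℚ-nonNeg 1) (ℚₚ.≤-trans d≥0 d≤D))
  run-approximates-χ (suc m) m+2≤n s ((s₀ , s₀∈χ , s₀→s) , _)
    with run-approximates-χ m (ℕₚ.<⇒≤ m+2≤n) s₀ s₀∈χ
  ... | t₀ , t₀∈R , s₀≈t₀
    with transition-approx p q (suc (suc m)) (toℚ-*-monoʳ-≤ (suc m) d≤D)
           (*-nonNeg {toℚ (suc m)} (toℚ-nonNeg (suc m)) d≥0) s₀≈t₀ s₀→s
  ... | t′ , t₀→t′ , s≈t′
    with representativeOf m m+2≤n t′ (t₀ , t₀∈R , t₀→t′)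
  ... | t , t∈R , t′∼t =
    t , t∈R ,
    subst₂ (λ e E → Approx e E s t) (≡-sym (toℚ-suc-* (suc m) d)) (≡-sym (toℚ-suc-* (suc m) D))
      (approx-trans {s = s} {t′} {t} s≈t′ (sameBox-approx {t′ = t′} {t} δ₂≤D t′∼t))

lemma1 : (n : ℕ) → 1 ℕ.≤ n → (p q : ℕ → ℕ) →
    (∀ i → 1 ℕ.≤ i → i ℕ.≤ n → 1 ℕ.≤ p i) →
    (∀ i j → 1 ℕ.≤ i → i ℕ.≤ j → j ℕ.≤ n → q j ℕ.≤ q i) →
    (ε : ℚ) → ℚ.0ℚ ℚ.< ε →
    (R : ℕ → State → Set) → IsRunA′ p q n ε R →
    ∀ i → 1 ℕ.≤ i → i ℕ.≤ n → ∀ s → χ p q i s →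
    Σ State λ t → R i t ×
      (toℚ (Lmax t) ℚ.≤ toℚ (Lmax s) ℚ.+ toℚ i ℚ.* (δ₁ p n ε ℚ.⊔ δ₂ p q n ε)) ×
      (toℚ (Cmax s) ℚ.- toℚ i ℚ.* δ₁ p n ε ℚ.≤ toℚ (Cmax t)) ×
      (toℚ (Cmax t) ℚ.≤ toℚ (Cmax s) ℚ.+ toℚ i ℚ.* δ₁ p n ε)
lemma1 n _ p q _ _ ε ε>0 R run (suc m) _ i≤n s s∈χ
  with run-approximates-χ ε>0 run m i≤n s s∈χ
... | t , t∈R , Lt≲Ls , Ct≲Cs , Cs≲Ct = t , t∈R , bound Lt≲Ls , ≲⇒-≤ Cs≲Ct , bound Ct≲Cs
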